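{- Let $S=\{\sigma,\mu\}$, where $\mu,\sigma$ are the morphisms of $\{0,1\}^*$ given by $\mu(0)=01$, $\mu(1)=10$, $\sigma(0)=00$, $\sigma(1)=11$. Then the set of $S$-adic sequences contains uncountably many sequences with pairwise distinct complexity functions.
   Context: A binary sequence is an infinite word $\mathbf{w}\in\{0,1\}^{\mathbb{N}}$. Its complexity function is $n\mapsto|\mathcal{L}^{\mathbf{w}}_n|$, where $\mathcal{L}^{\mathbf{w}}_n$ is the set of factors (contiguous finite subwords) of $\mathbf{w}$ of length $n$. Given a set $S$ of morphisms of $\{0,1\}^*$, a binary sequence $\mathbf{w}$ is $S$-adic if there exist a sequence $(\sigma_n)_{n\ge1}$ with each $\sigma_n\in S$ and a sequence of letters $(a_n)_{n\ge1}$ in $\{0,1\}$ such that $\mathbf{w}=\lim_{n\to\infty}\sigma_1\cdots\sigma_n(a_na_na_n\cdots)$. -}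

module Defs where

open import Data.Bool using (Bool; true; false; _xor_)
open import Data.Nat using (ℕ; zero; suc; _+_; _≤_; ⌊_/2⌋)
open import Data.Fin using (Fin; toℕ)
open import Data.Vec using (Vec; lookup)
open import Data.List using (List; length)
open import Data.List.Relation.Unary.All using (All)
open import Data.List.Relation.Unary.Unique.Propositional using (Unique)
open import Data.List.Membership.Propositional using (_∈_)
open import Data.Product using (Σ; ∃; _×_)
open import Relation.Binary.PropositionalEquality using (_≡_; _≢_)

-- Binary letters: false = 0, true = 1.  Infinite binary words.
Word : Set
Word = ℕ → Bool

data Morph : Set where
  σ μ : Morph

-- Both morphisms are 2-uniform; letter i (i = false: first, true: second)
-- of the image of letter b.
--   σ(0) = 00, σ(1) = 11 ;  μ(0) = 01, μ(1) = 10
image : Morph → Bool → Bool → Bool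
image σ b i = b
image μ b i = b xor i

odd : ℕ → Bool
odd zero = false
odd (suc n) = not' (odd n)
  where
  not' : Bool → Bool
  not' true = false
  not' false = true

apply : Morph → Word → Word
apply τ x k = image τ (x ⌊ k /2⌋) (odd k)

-- compose ss n x = ss 0 (ss 1 (... (ss (n-1) x)))
compose : (ℕ → Morph) → ℕ → Word → Word
compose ss zero x = x
compose ss (suc n) x = apply (ss 0) (compose (λ k → ss (suc k)) n x)

constWord : Bool → Word
constWord a k = a

-- w is S-adic: w = lim_n σ_1 ⋯ σ_n (a_n a_n ⋯) (pointwise / product-topology
-- limit), indices shifted to start at 0: w = lim_n σ_0 ⋯ σ_n (a_n^ω).
IsSAdic : Word → Set
IsSAdic w =
  Σ (ℕ → Morph) λ ss → Σ (ℕ → Bool) λ as →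
    ∀ k → ∃ λ N → ∀ n → N ≤ n → compose ss (suc n) (constWord (as n)) k ≡ w k

IsFactor : Word → {n : ℕ} → Vec Bool n → Set
IsFactor w {n} u = ∃ λ i → ∀ (j : Fin n) → lookup u j ≡ w (i + toℕ j)

-- |L_n(w)| = c : there is a duplicate-free list of exactly the factors of
-- length n, of length c.
HasComplexity : Word → ℕ → ℕ → Set
HasComplexity w n c =
  Σ (List (Vec Bool n)) λ L →
    (length L ≡ c) × Unique L × All (IsFactor w) L ×
    (∀ (u : Vec Bool n) → IsFactor w u → u ∈ L)

DistinctComplexity : Word → Word → Set
DistinctComplexity w w' =
  ∃ λ n → Σ ℕ λ c → Σ ℕ λ c' →
    HasComplexity w n c × HasComplexity w' n c' × c ≢ c'

-- To x ∈ {0,1}^ℕ associate the limit word F(x) of the directive sequence μ μ τ₀ μ μ τ₁ ⋯,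
-- where τₖ is σ or μ according to xₖ.  Call w, w' separated if at some length m + 1 every
-- factor of w is a factor of w', and w' has a non-constant factor z of length m that w
-- lacks; then w has strictly fewer factors of length m.  Separation survives applying one
-- 2-uniform morphism τ to both words: factors of τ(w) of length 2m + 1 are windows of
-- images of factors of w of length m + 1, and τ(z) does not occur in τ(w), at an even
-- position because τ is injective, at an odd one because that would make z constant.
-- If x, y first differ at k, the shifted words F(xₖ xₖ₊₁ ⋯) and F(yₖ yₖ₊₁ ⋯) are separated
-- (one way or the other) by a finite computation of their factors of length 9, and F(x),
-- F(y) arise from them by applying the same 3k morphisms.

module Submission where

open import Defs
open import Data.Bool using (Bool; true; false)
open import Data.Bool.Properties using () renaming (_≟_ to _≟ᵇ_)
open import Data.Nat using (ℕ; zero; suc; _+_; _≤_; _<_; _∸_; ⌊_/2⌋; z≤n; s≤s)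
open import Data.Nat.Properties
open import Data.Fin using (Fin; toℕ) renaming (zero to #0; suc to #suc)
open import Data.Fin.Properties using (toℕ≤pred[n])
open import Data.Vec using (Vec; []; _∷_; lookup; truncate)
open import Data.Vec.Properties using (≡-dec; ∷-injectiveʳ)
open import Data.List using (List; []; _∷_; map; _++_; filter; length)
open import Data.List.Relation.Unary.All using (All; []; _∷_)
import Data.List.Relation.Unary.All as All
import Data.List.Relation.Unary.All.Properties as Allₚ
open import Data.List.Relation.Unary.Any using (here; there; any?)
open import Data.List.Membership.Propositional using (_∈_)
open import Data.List.Membership.Propositional.Properties
  using (∈-map⁺; ∈-map⁻; ∈-++⁺ˡ; ∈-++⁺ʳ; ∈-filter⁺; ∈-filter⁻)
open import Data.List.Relation.Unary.Unique.Propositional using (Unique)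
import Data.List.Relation.Unary.AllPairs as AllPairs
import Data.List.Relation.Unary.Unique.Propositional.Properties as Unique
open import Data.List.Relation.Binary.Sublist.Propositional using (⊆-refl)
open import Data.List.Relation.Binary.Sublist.Propositional.Properties
  using (filter⁺; length-mono-≤; to-≋)
open import Data.List.Relation.Binary.Pointwise using (Pointwise-≡⇒≡)
open import Data.Product using (Σ; ∃; ∃₂; _×_; _,_; proj₁; proj₂)
open import Data.Sum using (_⊎_; inj₁; inj₂; [_,_]′)
import Data.Sum as Sum
open import Data.Empty using (⊥-elim)
open import Function using (_∘_; case_of_)
open import Relation.Nullary using (¬_; Dec; yes; no)
open import Relation.Nullary.Decidable using (toWitness; toWitnessFalse)
open import Relation.Binary.PropositionalEquality

tail : {A : Set} → (ℕ → A) → ℕ → A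
tail s k = s (suc k)

drop : {A : Set} → ℕ → (ℕ → A) → ℕ → A
drop n s k = s (n + k)

image-first : ∀ τ b → image τ b false ≡ b
image-first σ b = refl
image-first μ false = refl
image-first μ true = refl

second : Morph → Bool → Bool
second τ b = image τ b true

second-involutive : ∀ τ b → second τ (second τ b) ≡ b
second-involutive σ b = refl
second-involutive μ false = refl
second-involutive μ true = refl

-- w = τ(v), as a record so that τ and v can be inferred from it.
record IsImage (τ : Morph) (v w : Word) : Set where
  constructor isImage
  field pointwise : w ≗ apply τ v

-- The limit word of a directive sequence

compose-+ : ∀ n m ss y → compose ss (n + m) y ≗ compose ss n (compose (drop n ss) m y)
compose-+ zero m ss y k = refl
compose-+ (suc n) m ss y k =
  cong (λ b → image (ss 0) b (odd k)) (compose-+ n m (tail ss) y ⌊ k /2⌋)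

compose-prefix : ∀ n ss (y y' : Word) k → k ≤ n → y 0 ≡ y' 0 →
                 compose ss n y k ≡ compose ss n y' k
compose-prefix zero ss y y' .zero z≤n eq = eq
compose-prefix (suc n) ss y y' k k≤1+n eq =
  cong (λ b → image (ss 0) b (odd k))
    (compose-prefix n (tail ss) y y' ⌊ k /2⌋ ⌊k/2⌋≤n eq)
  where ⌊k/2⌋≤n = ≤-trans (⌊n/2⌋-mono k≤1+n) (≤-pred (⌊n/2⌋<n n))

compose-head : ∀ m ss → compose ss m (constWord false) 0 ≡ false
compose-head zero ss = refl
compose-head (suc m) ss = trans (image-first (ss 0) _) (compose-head m (tail ss))

compose-stable : ∀ ss n k → k ≤ n →
                 compose ss n (constWord false) k ≡ compose ss k (constWord false) k
compose-stable ss n k k≤n = begin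
  compose ss n (constWord false) k
    ≡˘⟨ cong (λ t → compose ss t (constWord false) k) (m+[n∸m]≡n k≤n) ⟩
  compose ss (k + (n ∸ k)) (constWord false) k
    ≡⟨ compose-+ k (n ∸ k) ss (constWord false) k ⟩
  compose ss k (compose (drop k ss) (n ∸ k) (constWord false)) k
    ≡⟨ compose-prefix k ss _ _ k ≤-refl (compose-head (n ∸ k) (drop k ss)) ⟩
  compose ss k (constWord false) k ∎
  where open ≡-Reasoning

limitWord : (ℕ → Morph) → Word
limitWord ss k = compose ss (suc k) (constWord false) k

limitWord-unfold : ∀ ss → IsImage (ss 0) (limitWord (tail ss)) (limitWord ss)
limitWord-unfold ss = isImage λ k → cong (λ b → image (ss 0) b (odd k))
  (trans (compose-stable (tail ss) k ⌊ k /2⌋ (⌊n/2⌋≤n k))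
         (sym (compose-stable (tail ss) (suc ⌊ k /2⌋) ⌊ k /2⌋ (n≤1+n _))))

limitWord-isSAdic : ∀ ss → IsSAdic (limitWord ss)
limitWord-isSAdic ss = ss , (λ _ → false) , λ k → k , λ n k≤n →
  trans (compose-stable ss (suc n) k (m≤n⇒m≤1+n k≤n)) (sym (compose-stable ss (suc k) k (n≤1+n k)))

-- Factors as windows

window : Word → ℕ → (n : ℕ) → Vec Bool n
window w i zero = []
window w i (suc n) = w i ∷ window w (suc i) n

-- A vector read as a word.
at : ∀ {n} → Vec Bool n → Word
at [] k = false
at (b ∷ u) zero = b
at (b ∷ u) (suc k) = at u k

Fac : Word → ∀ {n} → Vec Bool n → Set
Fac w {n} u = ∃ λ i → u ≡ window w i n

window-ext : ∀ (f g : Word) p q n → (∀ k → k < n → f (p + k) ≡ g (q + k)) →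
             window f p n ≡ window g q n
window-ext f g p q zero h = refl
window-ext f g p q (suc n) h = cong₂ _∷_
  (subst₂ (λ i j → f i ≡ g j) (+-identityʳ p) (+-identityʳ q) (h 0 (s≤s z≤n)))
  (window-ext f g (suc p) (suc q) n λ k k<n →
    subst₂ (λ i j → f i ≡ g j) (+-suc p k) (+-suc q k) (h (suc k) (s≤s k<n)))

window-cong : ∀ {w w' : Word} → w ≗ w' → ∀ i n → window w i n ≡ window w' i n
window-cong e i n = window-ext _ _ i i n λ k _ → e (i + k)

at-window : ∀ (f : Word) p n k → k < n → at (window f p n) k ≡ f (p + k)
at-window f p (suc n) zero _ = cong f (sym (+-identityʳ p))
at-window f p (suc n) (suc k) (s≤s k<n) = trans (at-window f (suc p) n k k<n) (cong f (sym (+-suc p k)))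

window-≡⇒pointwise : ∀ (f g : Word) p q n → window f p n ≡ window g q n →
                     ∀ k → k < n → f (p + k) ≡ g (q + k)
window-≡⇒pointwise f g p q n eq k k<n = begin
  f (p + k)              ≡˘⟨ at-window f p n k k<n ⟩
  at (window f p n) k    ≡⟨ cong (λ u → at u k) eq ⟩
  at (window g q n) k    ≡⟨ at-window g q n k k<n ⟩
  g (q + k)              ∎
  where open ≡-Reasoning

at-ext : ∀ {n} (u u' : Vec Bool n) → (∀ k → k < n → at u k ≡ at u' k) → u ≡ u'
at-ext [] [] h = refl
at-ext (b ∷ u) (b' ∷ u') h = cong₂ _∷_ (h 0 (s≤s z≤n)) (at-ext u u' λ k k<n → h (suc k) (s≤s k<n))

Fac⇒IsFactor : ∀ w {n} (u : Vec Bool n) → Fac w u → IsFactor w u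
Fac⇒IsFactor w u (i , refl) = i , lookup-window i _
  where
  lookup-window : ∀ i n (j : Fin n) → lookup (window w i n) j ≡ w (i + toℕ j)
  lookup-window i (suc n) #0 = cong w (sym (+-identityʳ i))
  lookup-window i (suc n) (#suc j) = trans (lookup-window (suc i) n j) (cong w (sym (+-suc i (toℕ j))))

IsFactor⇒Fac : ∀ w {n} (u : Vec Bool n) → IsFactor w u → Fac w u
IsFactor⇒Fac w u (i , h) = i , window-lookup i u h
  where
  window-lookup : ∀ i {n} (u : Vec Bool n) → (∀ j → lookup u j ≡ w (i + toℕ j)) → u ≡ window w i n
  window-lookup i [] h = refl
  window-lookup i (b ∷ u) h = cong₂ _∷_ (trans (h #0) (cong w (+-identityʳ i)))
    (window-lookup (suc i) u λ j → trans (h (#suc j)) (cong w (+-suc i (toℕ j))))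

dbl : ℕ → ℕ
dbl zero = zero
dbl (suc n) = suc (suc (dbl n))

dbl-mono-≤ : ∀ {a b} → a ≤ b → dbl a ≤ dbl b
dbl-mono-≤ z≤n = z≤n
dbl-mono-≤ (s≤s a≤b) = s≤s (s≤s (dbl-mono-≤ a≤b))

⌊dbl[i]+r/2⌋≡i+⌊r/2⌋ : ∀ i r → ⌊ dbl i + r /2⌋ ≡ i + ⌊ r /2⌋
⌊dbl[i]+r/2⌋≡i+⌊r/2⌋ zero r = refl
⌊dbl[i]+r/2⌋≡i+⌊r/2⌋ (suc i) r = cong suc (⌊dbl[i]+r/2⌋≡i+⌊r/2⌋ i r)

odd[2+n]≡odd[n] : ∀ n → odd (suc (suc n)) ≡ odd n
odd[2+n]≡odd[n] n with odd n
... | true = refl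
... | false = refl

odd[dbl[i]+r]≡odd[r] : ∀ i r → odd (dbl i + r) ≡ odd r
odd[dbl[i]+r]≡odd[r] zero r = refl
odd[dbl[i]+r]≡odd[r] (suc i) r = trans (odd[2+n]≡odd[n] (dbl i + r)) (odd[dbl[i]+r]≡odd[r] i r)

r<dbl[m]⇒⌊r/2⌋<m : ∀ r m → r < dbl m → ⌊ r /2⌋ < m
r<dbl[m]⇒⌊r/2⌋<m zero (suc m) _ = s≤s z≤n
r<dbl[m]⇒⌊r/2⌋<m (suc zero) (suc m) _ = s≤s z≤n
r<dbl[m]⇒⌊r/2⌋<m (suc (suc r)) (suc m) (s≤s (s≤s r<m)) = s≤s (r<dbl[m]⇒⌊r/2⌋<m r m r<m)

parity : ∀ p → ∃₂ λ i (o : Fin 2) → p ≡ dbl i + toℕ o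
parity zero = 0 , #0 , refl
parity (suc zero) = 0 , #suc #0 , refl
parity (suc (suc p)) with parity p
... | i , o , eq = suc i , o , cong (suc ∘ suc) eq

apply-shift : ∀ τ (f : Word) i r → apply τ f (dbl i + r) ≡ image τ (f (i + ⌊ r /2⌋)) (odd r)
apply-shift τ f i r =
  cong₂ (image τ) (cong f (⌊dbl[i]+r/2⌋≡i+⌊r/2⌋ i r)) (odd[dbl[i]+r]≡odd[r] i r)

apply-even : ∀ τ (f : Word) s → apply τ f (dbl s) ≡ f s
apply-even τ f s = begin
  apply τ f (dbl s)            ≡˘⟨ cong (apply τ f) (+-identityʳ (dbl s)) ⟩
  apply τ f (dbl s + 0)        ≡⟨ apply-shift τ f s 0 ⟩
  image τ (f (s + 0)) false    ≡⟨ image-first τ _ ⟩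
  f (s + 0)                    ≡⟨ cong f (+-identityʳ s) ⟩
  f s                          ∎
  where open ≡-Reasoning

apply-odd : ∀ τ (f : Word) s → apply τ f (suc (dbl s)) ≡ second τ (f s)
apply-odd τ f s = begin
  apply τ f (suc (dbl s))      ≡⟨ cong (apply τ f) (+-comm 1 (dbl s)) ⟩
  apply τ f (dbl s + 1)        ≡⟨ apply-shift τ f s 1 ⟩
  second τ (f (s + 0))         ≡⟨ cong (second τ ∘ f) (+-identityʳ s) ⟩
  second τ (f s)               ∎
  where open ≡-Reasoning

window-image : ∀ {τ v w} → IsImage τ v w → ∀ i o m n → o + n ≤ dbl m →
  window w (dbl i + o) n ≡ window (apply τ (at (window v i m))) o n
window-image {τ} {v} (isImage e) i o m n o+n≤2m =
  trans (window-cong e _ n) (window-ext _ _ (dbl i + o) o n pointwise)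
  where
  open ≡-Reasoning
  pointwise : ∀ k → k < n → apply τ v (dbl i + o + k) ≡ apply τ (at (window v i m)) (o + k)
  pointwise k k<n = begin
    apply τ v (dbl i + o + k)                  ≡⟨ cong (apply τ v) (+-assoc (dbl i) o k) ⟩
    apply τ v (dbl i + (o + k))                ≡⟨ apply-shift τ v i (o + k) ⟩
    image τ (v (i + j)) (odd (o + k))          ≡˘⟨ cong (λ b → image τ b (odd (o + k))) v[i+j] ⟩
    image τ (at (window v i m) j) (odd (o + k)) ∎
    where
    j = ⌊ o + k /2⌋
    v[i+j] = at-window v i m j (r<dbl[m]⇒⌊r/2⌋<m (o + k) m (≤-trans (+-monoʳ-< o k<n) o+n≤2m))

Enumerates : Word → (n : ℕ) → List (Vec Bool n) → Set
Enumerates w n L = All (Fac w) L × (∀ (u : Vec Bool n) → Fac w u → u ∈ L)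

FactorsIncluded : Word → Word → ℕ → Set
FactorsIncluded v v' n = ∀ (u : Vec Bool n) → Fac v u → Fac v' u

imageWindow : Morph → ∀ m → Fin 2 → Vec Bool (suc m) → Vec Bool (suc (dbl m))
imageWindow τ m o c = window (apply τ (at c)) (toℕ o) (suc (dbl m))

imageWindows : Morph → ∀ m → List (Vec Bool (suc m)) → List (Vec Bool (suc (dbl m)))
imageWindows τ m [] = []
imageWindows τ m (c ∷ L) = imageWindow τ m #0 c ∷ imageWindow τ m (#suc #0) c ∷ imageWindows τ m L

∈-imageWindows : ∀ {τ m c} {L : List (Vec Bool (suc m))} o → c ∈ L →
                 imageWindow τ m o c ∈ imageWindows τ m L
∈-imageWindows #0 (here refl) = here refl
∈-imageWindows (#suc #0) (here refl) = there (here refl)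
∈-imageWindows o (there c∈L) = there (there (∈-imageWindows o c∈L))

window-imageWindow : ∀ {τ v w} → IsImage τ v w → ∀ m i o →
  window w (dbl i + toℕ o) (suc (dbl m)) ≡ imageWindow τ m o (window v i (suc m))
window-imageWindow e m i o =
  window-image e i (toℕ o) (suc m) (suc (dbl m)) (+-monoˡ-≤ (suc (dbl m)) (toℕ≤pred[n] o))

Fac-imageWindow : ∀ {τ v w m} → IsImage τ v w → ∀ o (c : Vec Bool (suc m)) → Fac v c →
                  Fac w (imageWindow τ m o c)
Fac-imageWindow e o c (i , refl) = dbl i + toℕ o , sym (window-imageWindow e _ i o)

Enumerates-apply : ∀ {τ v w m L} → IsImage τ v w → Enumerates v (suc m) L →
                   Enumerates w (suc (dbl m)) (imageWindows τ m L)
Enumerates-apply {τ} {v} {w} {m} {L} e (sound , complete) = sound′ sound , complete′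
  where
  sound′ : ∀ {L} → All (Fac v) L → All (Fac w) (imageWindows τ m L)
  sound′ [] = []
  sound′ (fc ∷ fcs) = Fac-imageWindow e #0 _ fc ∷ Fac-imageWindow e (#suc #0) _ fc ∷ sound′ fcs
  complete′ : ∀ u → Fac w u → u ∈ imageWindows τ m L
  complete′ u (p , refl) with parity p
  ... | i , o , refl = subst (_∈ imageWindows τ m L) (sym (window-imageWindow e m i o))
                         (∈-imageWindows o (complete _ (i , refl)))

FactorsIncluded-apply : ∀ {τ v w v' w' m} → IsImage τ v w → IsImage τ v' w' →
  FactorsIncluded v v' (suc m) → FactorsIncluded w w' (suc (dbl m))
FactorsIncluded-apply {m = m} e e' incl u (p , refl) with parity p
... | i , o , refl = subst (Fac _) (sym (window-imageWindow e m i o))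
                       (Fac-imageWindow e' o _ (incl _ (i , refl)))

window-truncate : ∀ w i {m n} (m≤n : m ≤ n) → truncate m≤n (window w i n) ≡ window w i m
window-truncate w i {zero} _ = refl
window-truncate w i {suc m} (s≤s m≤n) = cong (w i ∷_) (window-truncate w (suc i) m≤n)

Fac-truncate : ∀ {w m n} (m≤n : m ≤ n) {c : Vec Bool n} → Fac w c → Fac w (truncate m≤n c)
Fac-truncate m≤n (i , refl) = i , window-truncate _ i m≤n

Enumerates-truncate : ∀ {w m n L} (m≤n : m ≤ n) → Enumerates w n L →
                      Enumerates w m (map (truncate m≤n) L)
Enumerates-truncate {w} m≤n (sound , complete) =
  Allₚ.map⁺ (All.map (Fac-truncate m≤n) sound) ,
  λ { u (i , refl) → subst (_∈ _) (window-truncate w i m≤n)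
                       (∈-map⁺ (truncate m≤n) (complete _ (i , refl))) }

FactorsIncluded-truncate : ∀ {v v' m n} (m≤n : m ≤ n) → FactorsIncluded v v' n → FactorsIncluded v v' m
FactorsIncluded-truncate {v} {v'} m≤n incl u (i , refl) with incl _ (i , refl)
... | j , eq = j , (begin
  window v i _                  ≡˘⟨ window-truncate v i m≤n ⟩
  truncate m≤n (window v i _)   ≡⟨ cong (truncate m≤n) eq ⟩
  truncate m≤n (window v' j _)  ≡⟨ window-truncate v' j m≤n ⟩
  window v' j _                 ∎)
  where open ≡-Reasoning

-- Separation of two words and its transport along a morphism

Steady : ∀ {m} → Vec Bool m → Set
Steady {m} z = ∀ s → suc s < m → at z (suc s) ≡ at z s

NonConstant : ∀ {m} → Vec Bool m → Set
NonConstant z = ¬ Steady z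

imageVec : Morph → ∀ {m} → Vec Bool m → Vec Bool (dbl m)
imageVec τ {m} z = window (apply τ (at z)) 0 (dbl m)

at-imageVec : ∀ τ {m} (z : Vec Bool m) q → q < dbl m → at (imageVec τ z) q ≡ apply τ (at z) q
at-imageVec τ {m} z = at-window (apply τ (at z)) 0 (dbl m)

imageVec-injective : ∀ τ {m} (z c : Vec Bool m) → imageVec τ z ≡ imageVec τ c → z ≡ c
imageVec-injective τ z c eq = at-ext z c λ s s<m →
  let 2s<2m = <⇒≤ (dbl-mono-≤ s<m) in begin
    at z s                          ≡˘⟨ apply-even τ (at z) s ⟩
    apply τ (at z) (dbl s)          ≡˘⟨ at-imageVec τ z (dbl s) 2s<2m ⟩
    at (imageVec τ z) (dbl s)       ≡⟨ cong (λ u → at u (dbl s)) eq ⟩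
    at (imageVec τ c) (dbl s)       ≡⟨ at-imageVec τ c (dbl s) 2s<2m ⟩
    apply τ (at c) (dbl s)          ≡⟨ apply-even τ (at c) s ⟩
    at c s                          ∎
  where open ≡-Reasoning

imageVec-steady⁻ : ∀ τ {m} (z : Vec Bool m) → Steady (imageVec τ z) → Steady z
imageVec-steady⁻ τ z h s 1+s<m =
  let 2+2s<2m = <⇒≤ (dbl-mono-≤ 1+s<m)
      1+2s<2m = dbl-mono-≤ (<⇒≤ 1+s<m) in begin
    at z (suc s)                           ≡˘⟨ apply-even τ (at z) (suc s) ⟩
    apply τ (at z) (dbl (suc s))           ≡˘⟨ at-imageVec τ z _ 2+2s<2m ⟩
    at (imageVec τ z) (dbl (suc s))        ≡⟨ h (suc (dbl s)) 2+2s<2m ⟩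
    at (imageVec τ z) (suc (dbl s))        ≡⟨ h (dbl s) 1+2s<2m ⟩
    at (imageVec τ z) (dbl s)              ≡⟨ at-imageVec τ z _ (<⇒≤ 1+2s<2m) ⟩
    apply τ (at z) (dbl s)                 ≡⟨ apply-even τ (at z) s ⟩
    at z s                                 ∎
  where open ≡-Reasoning

-- If τ(z) occurs at an odd position of τ(f), the letters of z are matched alternately
-- against first and second letters of images, which forces z(s+1) = second(second(z s)).
shifted-image⇒steady : ∀ τ (f : Word) {m} (z : Vec Bool m) →
  (∀ q → q < dbl m → apply τ (at z) q ≡ apply τ f (suc q)) → Steady z
shifted-image⇒steady τ f z h s 1+s<m =
  let 2+2s<2m = <⇒≤ (dbl-mono-≤ 1+s<m)
      1+2s<2m = dbl-mono-≤ (<⇒≤ 1+s<m) in begin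
    at z (suc s)                               ≡˘⟨ apply-even τ (at z) (suc s) ⟩
    apply τ (at z) (dbl (suc s))               ≡⟨ h (dbl (suc s)) 2+2s<2m ⟩
    apply τ f (suc (dbl (suc s)))              ≡⟨ apply-odd τ f (suc s) ⟩
    second τ (f (suc s))                       ≡˘⟨ cong (second τ) (apply-even τ f (suc s)) ⟩
    second τ (apply τ f (dbl (suc s)))         ≡˘⟨ cong (second τ) (h (suc (dbl s)) 1+2s<2m) ⟩
    second τ (apply τ (at z) (suc (dbl s)))    ≡⟨ cong (second τ) (apply-odd τ (at z) s) ⟩
    second τ (second τ (at z s))               ≡⟨ second-involutive τ (at z s) ⟩
    at z s                                     ∎
  where open ≡-Reasoning

Fac-imageVec : ∀ {τ v w m} {z : Vec Bool m} → IsImage τ v w → Fac v z → Fac w (imageVec τ z)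
Fac-imageVec {m = m} e (j , refl) = dbl j + 0 , sym (window-image e j 0 m (dbl m) ≤-refl)

¬Fac-imageVec : ∀ {τ v w m} {z : Vec Bool m} → IsImage τ v w → NonConstant z → ¬ Fac v z →
                ¬ Fac w (imageVec τ z)
¬Fac-imageVec {τ} {v} {m = m} {z} e nonConstant z∉v (p , occurs) with parity p
... | i , #0 , refl =
  z∉v (i , imageVec-injective τ z _ (trans occurs (window-image e i 0 m (dbl m) ≤-refl)))
... | i , #suc #0 , refl =
  nonConstant (shifted-image⇒steady τ (at (window v i (suc m))) z
    (window-≡⇒pointwise _ _ 0 1 (dbl m) (trans occurs (window-image e i 1 (suc m) (dbl m) (n≤1+n _)))))

record Separated (v v' : Word) : Set where
  field
    m           : ℕ
    factors     : List (Vec Bool (suc m))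
    factors'    : List (Vec Bool (suc m))
    enumerates  : Enumerates v (suc m) factors
    enumerates' : Enumerates v' (suc m) factors'
    included    : FactorsIncluded v v' (suc m)
    witness     : Vec Bool m
    nonConstant : NonConstant witness
    witness∈    : Fac v' witness
    witness∉    : ¬ Fac v witness

Separated-apply : ∀ {τ v v' w w'} → IsImage τ v w → IsImage τ v' w' → Separated v v' → Separated w w'
Separated-apply {τ} e e' S = record
  { m           = dbl m
  ; factors     = imageWindows τ m factors
  ; factors'    = imageWindows τ m factors'
  ; enumerates  = Enumerates-apply e enumerates
  ; enumerates' = Enumerates-apply e' enumerates'
  ; included    = FactorsIncluded-apply e e' included
  ; witness     = imageVec τ witness
  ; nonConstant = nonConstant ∘ imageVec-steady⁻ τ witness
  ; witness∈    = Fac-imageVec e' witness∈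
  ; witness∉    = ¬Fac-imageVec e nonConstant witness∉
  }
  where open Separated S

allVecs : ∀ n → List (Vec Bool n)
allVecs zero = [] ∷ []
allVecs (suc n) = map (false ∷_) (allVecs n) ++ map (true ∷_) (allVecs n)

∈-allVecs : ∀ {n} (u : Vec Bool n) → u ∈ allVecs n
∈-allVecs [] = here refl
∈-allVecs (false ∷ u) = ∈-++⁺ˡ (∈-map⁺ (false ∷_) (∈-allVecs u))
∈-allVecs (true ∷ u) = ∈-++⁺ʳ (map (false ∷_) (allVecs _)) (∈-map⁺ (true ∷_) (∈-allVecs u))

allVecs-unique : ∀ n → Unique (allVecs n)
allVecs-unique zero = [] AllPairs.∷ AllPairs.[]
allVecs-unique (suc n) =
  Unique.++⁺ (Unique.map⁺ ∷-injectiveʳ (allVecs-unique n))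
             (Unique.map⁺ ∷-injectiveʳ (allVecs-unique n)) disjoint
  where
  disjoint : ∀ {u} → ¬ (u ∈ map (false ∷_) (allVecs n) × u ∈ map (true ∷_) (allVecs n))
  disjoint (p , q) with ∈-map⁻ (false ∷_) p | ∈-map⁻ (true ∷_) q
  ... | _ , _ , refl | _ , _ , ()

_∈?_ : ∀ {n} (u : Vec Bool n) (L : List (Vec Bool n)) → Dec (u ∈ L)
u ∈? L = any? (≡-dec _≟ᵇ_ u) L

module _ {A : Set} {P Q : A → Set} (P? : ∀ a → Dec (P a)) (Q? : ∀ a → Dec (Q a))
         (P⇒Q : ∀ {a} → P a → Q a) where

  length-filter-< : ∀ {xs z} → z ∈ xs → Q z → ¬ P z → length (filter P? xs) < length (filter Q? xs)
  length-filter-< {xs} z∈xs Qz ¬Pz = ≤∧≢⇒< (length-mono-≤ sublist) λ eq →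
    ¬Pz (proj₂ (∈-filter⁻ P? {xs = xs} (subst (_ ∈_) (sym (same eq)) (∈-filter⁺ Q? z∈xs Qz))))
    where
    sublist = filter⁺ P? Q? {as = xs} (λ { refl → P⇒Q }) ⊆-refl
    same : length (filter P? xs) ≡ length (filter Q? xs) → filter P? xs ≡ filter Q? xs
    same eq = Pointwise-≡⇒≡ (to-≋ eq sublist)

-- Enumerations may contain duplicates, so factors are counted among all vectors.
complexity : ∀ {n} → List (Vec Bool n) → ℕ
complexity {n} L = length (filter (_∈? L) (allVecs n))

Enumerates⇒HasComplexity : ∀ {w n L} → Enumerates w n L → HasComplexity w n (complexity L)
Enumerates⇒HasComplexity {w} {n} {L} (sound , complete) =
  filter (_∈? L) (allVecs n) , refl , Unique.filter⁺ (_∈? L) (allVecs-unique n) ,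
  All.map (λ u∈L → Fac⇒IsFactor w _ (All.lookup sound u∈L)) (Allₚ.all-filter (_∈? L) (allVecs n)) ,
  λ u u∈w → ∈-filter⁺ (_∈? L) (∈-allVecs u) (complete u (IsFactor⇒Fac w u u∈w))

Separated⇒DistinctComplexity : ∀ {v v'} → Separated v v' → DistinctComplexity v v'
Separated⇒DistinctComplexity S =
  m , _ , _ , Enumerates⇒HasComplexity enum , Enumerates⇒HasComplexity enum' , <⇒≢ fewer
  where
  open Separated S
  enum = Enumerates-truncate (n≤1+n m) enumerates
  enum' = Enumerates-truncate (n≤1+n m) enumerates'
  included′ = FactorsIncluded-truncate (n≤1+n m) included
  fewer = length-filter-< (_∈? _) (_∈? _)
    (λ u∈L → proj₂ enum' _ (included′ _ (All.lookup (proj₁ enum) u∈L)))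
    (∈-allVecs witness) (proj₂ enum' witness witness∈) (witness∉ ∘ All.lookup (proj₁ enum))

DistinctComplexity-sym : ∀ {w w'} → DistinctComplexity w w' → DistinctComplexity w' w
DistinctComplexity-sym (n , c , c' , h , h' , c≢c') = n , c' , c , h' , h , c≢c' ∘ sym

-- The directive sequences μ μ τ₀ μ μ τ₁ ⋯

morphOf : Bool → Morph
morphOf false = σ
morphOf true = μ

directive : (ℕ → Bool) → ℕ → Morph
directive x zero = μ
directive x (suc zero) = μ
directive x (suc (suc zero)) = morphOf (x 0)
directive x (suc (suc (suc n))) = directive (tail x) n

sequence : (ℕ → Bool) → Word
sequence x = limitWord (directive x)

Separated-sequence : ∀ x y → x 0 ≡ y 0 → Separated (sequence (tail x)) (sequence (tail y)) →
                     Separated (sequence x) (sequence y)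
Separated-sequence x y x₀≡y₀ S =
  Separated-apply (limitWord-unfold (directive x)) (limitWord-unfold (directive y))
    (Separated-apply (limitWord-unfold (tail (directive x))) (limitWord-unfold (tail (directive y)))
      (Separated-apply (limitWord-unfold (tail (tail (directive x))))
        (subst (λ b → IsImage (morphOf b) (sequence (tail y)) (limitWord (tail (tail (directive y)))))
               (sym x₀≡y₀) (limitWord-unfold (tail (tail (directive y))))) S))

μ-image-01-10 : ∀ {u v} → IsImage μ u v → Fac v (false ∷ true ∷ []) × Fac v (true ∷ false ∷ [])
μ-image-01-10 {u} {v} e = by-cases (u 0) (u 1) λ o o≤2 → window-image e 0 o 2 2 (+-monoˡ-≤ 2 o≤2)
  where
  by-cases : ∀ a b → (∀ o → o ≤ 2 → window v o 2 ≡ window (apply μ (at (a ∷ b ∷ []))) o 2) →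
             Fac v (false ∷ true ∷ []) × Fac v (true ∷ false ∷ [])
  by-cases false false h = (0 , sym (h 0 z≤n)) , (1 , sym (h 1 (s≤s z≤n)))
  by-cases false true  h = (0 , sym (h 0 z≤n)) , (2 , sym (h 2 ≤-refl))
  by-cases true  false h = (2 , sym (h 2 ≤-refl)) , (0 , sym (h 0 z≤n))
  by-cases true  true  h = (1 , sym (h 1 (s≤s z≤n))) , (0 , sym (h 0 z≤n))

-- μ(01) = 0110 and μ(10) = 1001 together contain all four words of length 2.
μμ-image-enumerates₂ : ∀ {u v w} → IsImage μ u v → IsImage μ v w → Enumerates w 2 (allVecs 2)
μμ-image-enumerates₂ {v = v} {w} e e' =
  (prefix (#suc #0) has10 ∷ prefix #0 has01 ∷ prefix #0 has10 ∷ prefix (#suc #0) has01 ∷ []) ,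
  λ u _ → ∈-allVecs u
  where
  has01 = proj₁ (μ-image-01-10 e)
  has10 = proj₂ (μ-image-01-10 e)
  prefix : ∀ o {c} → Fac v c → Fac w (truncate (n≤1+n 2) (imageWindow μ 1 o c))
  prefix o fc = Fac-truncate (n≤1+n 2) (Fac-imageWindow e' o _ fc)

level₉ : Morph → List (Vec Bool 9)
level₉ τ = imageWindows μ 4 (imageWindows μ 2 (imageWindows τ 1 (allVecs 2)))

enumerates₉ : ∀ x {b} → x 0 ≡ b → Enumerates (sequence x) 9 (level₉ (morphOf b))
enumerates₉ x refl =
  Enumerates-apply (limitWord-unfold (directive x))
    (Enumerates-apply (limitWord-unfold (tail (directive x)))
      (Enumerates-apply (limitWord-unfold (tail (tail (directive x))))
        (μμ-image-enumerates₂ (limitWord-unfold (tail (directive (tail x))))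
                              (limitWord-unfold (directive (tail x))))))

level₇ : Morph → List (Vec Bool 7)
level₇ τ = map (truncate (m≤m+n 7 2)) (level₉ τ)

level₆ : Morph → List (Vec Bool 6)
level₆ τ = map (truncate (m≤m+n 6 3)) (level₉ τ)

-- 010010 occurs in μ³(00) but in no image under μ²σ.
witness₆ : Vec Bool 6
witness₆ = false ∷ true ∷ false ∷ false ∷ true ∷ false ∷ []

level₇σ⊆level₇μ : All (_∈ level₇ μ) (level₇ σ)
level₇σ⊆level₇μ = toWitness {a? = All.all? (_∈? level₇ μ) (level₇ σ)} _

witness₆∈level₆μ : witness₆ ∈ level₆ μ
witness₆∈level₆μ = toWitness {a? = witness₆ ∈? level₆ μ} _

witness₆∉level₆σ : ¬ witness₆ ∈ level₆ σ
witness₆∉level₆σ = toWitnessFalse {a? = witness₆ ∈? level₆ σ} _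

separated-base : ∀ x y → x 0 ≡ false → y 0 ≡ true → Separated (sequence x) (sequence y)
separated-base x y x₀≡0 y₀≡1 = record
  { m           = 6
  ; factors     = level₇ σ
  ; factors'    = level₇ μ
  ; enumerates  = enum₇ x x₀≡0
  ; enumerates' = enum₇ y y₀≡1
  ; included    = λ u u∈x →
      All.lookup (proj₁ (enum₇ y y₀≡1)) (All.lookup level₇σ⊆level₇μ (proj₂ (enum₇ x x₀≡0) u u∈x))
  ; witness     = witness₆
  ; nonConstant = λ steady → case steady 0 (s≤s (s≤s z≤n)) of λ ()
  ; witness∈    = All.lookup (proj₁ (enum₆ y y₀≡1)) witness₆∈level₆μ
  ; witness∉    = witness₆∉level₆σ ∘ proj₂ (enum₆ x x₀≡0) witness₆
  }
  where
  enum₇ : ∀ x {b} → x 0 ≡ b → Enumerates (sequence x) 7 (level₇ (morphOf b))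
  enum₇ x x₀≡b = Enumerates-truncate (m≤m+n 7 2) (enumerates₉ x x₀≡b)
  enum₆ : ∀ x {b} → x 0 ≡ b → Enumerates (sequence x) 6 (level₆ (morphOf b))
  enum₆ x x₀≡b = Enumerates-truncate (m≤m+n 6 3) (enumerates₉ x x₀≡b)

separated-head : ∀ x y → x 0 ≢ y 0 →
                 Separated (sequence x) (sequence y) ⊎ Separated (sequence y) (sequence x)
separated-head x y x₀≢y₀ with x 0 in x₀≡ | y 0 in y₀≡
... | false | true  = inj₁ (separated-base x y x₀≡ y₀≡)
... | true  | false = inj₂ (separated-base y x y₀≡ x₀≡)
... | false | false = ⊥-elim (x₀≢y₀ refl)
... | true  | true  = ⊥-elim (x₀≢y₀ refl)

separated : ∀ k x y → x k ≢ y k →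
            Separated (sequence x) (sequence y) ⊎ Separated (sequence y) (sequence x)
separated zero x y x₀≢y₀ = separated-head x y x₀≢y₀
separated (suc k) x y xₖ≢yₖ with x 0 ≟ᵇ y 0
... | no x₀≢y₀ = separated-head x y x₀≢y₀
... | yes x₀≡y₀ = Sum.map (Separated-sequence x y x₀≡y₀) (Separated-sequence y x (sym x₀≡y₀))
                          (separated k (tail x) (tail y) xₖ≢yₖ)

theorem9p1 : Σ ((ℕ → Bool) → Word) λ F →
    (∀ x → IsSAdic (F x)) ×
    (∀ x y → (∃ λ k → x k ≢ y k) → DistinctComplexity (F x) (F y))
theorem9p1 = sequence , (λ x → limitWord-isSAdic (directive x)) , λ x y (k , xₖ≢yₖ) →
  [ Separated⇒DistinctComplexity
  , DistinctComplexity-sym {sequence y} {sequence x} ∘ Separated⇒DistinctComplexity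
  ]′ (separated k x y xₖ≢yₖ)
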